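{- Suppose $\vec T$ satisfies Condition 1 or Condition 3 at every vertex of $H$, but does not satisfy Condition 1 at every vertex of $H$. Then at least one of the following holds: (i) $H$ has more edges than vertices; (ii) there are at least two vertices of $H$ at which $\vec T$ does not satisfy Condition 1; (iii) $K$ is connected.
   Context: $H$ is a connected finite simple graph with no leaves, vertices $1,\dots,t$, $k$ edges, oriented arbitrarily with directed edges $\overrightarrow{a_1a_2},\dots,\overrightarrow{a_{2k-1}a_{2k}}$; $\Gamma(b)=\{i:a_i=b\}$. $G$ is a finite simple graph and $\vec G$ its symmetric digraph. $\vec T=(\vec T_1,\vec T_2)$ is a $2k$-tuple of edges of $\vec G$ with $\vec T_1=(\overrightarrow{v_1v_2},\dots,\overrightarrow{v_{2k-1}v_{2k}})$, $\vec T_2=(\overrightarrow{w_1w_2},\dots,\overrightarrow{w_{2k-1}w_{2k}})$. $K$ is the undirected subgraph of $G$ consisting of the edges $v_{2i-1}v_{2i}$ and $w_{2i-1}w_{2i}$. Conditions at a vertex $b$ of $H$: Condition 1: the $v_i$, $i\in\Gamma(b)$, are all equal and the $w_i$, $i\in\Gamma(b)$, are all equal. Condition 3: there are vertices $x,y$ of $G$ such that for every $i\in\Gamma(b)$, either ($v_i=x$, $w_i=y$) or ($v_i=y$, $w_i=x$). -}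

module Defs where

open import Data.Nat using (ℕ; _<_)
open import Data.Fin using (Fin; zero; suc)
open import Data.Fin.Properties using (_≟_)
open import Data.Product using (Σ; ∃; _×_; _,_)
open import Data.Sum using (_⊎_)
open import Data.List using (List; length; filter; allFin; cartesianProduct)
open import Relation.Nullary using (¬_)
open import Relation.Binary.PropositionalEquality using (_≡_; _≢_)
open import Relation.Binary.Construct.Closure.ReflexiveTransitive using (Star)

record SimpleGraph (n : ℕ) : Set₁ where
  field
    Adj    : Fin n → Fin n → Set
    sym    : ∀ {x y} → Adj x y → Adj y x
    irrefl : ∀ {x} → ¬ Adj x x
open SimpleGraph public

-- Positions 1..2k are encoded as pairs (i , s) with i : Fin k (the edge) and
-- s : Fin 2 (0 = tail, 1 = head).  Position (i , 0) is 2i-1 and (i , 1) is 2i.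
Pos : ℕ → Set
Pos k = Fin k × Fin 2

-- An oriented graph H on vertices Fin t with k edges:
-- a i zero = a_{2i-1} (tail), a i (suc zero) = a_{2i} (head).
Orient : ℕ → ℕ → Set
Orient t k = Fin k → Fin 2 → Fin t

tl hd : Fin 2
tl = zero
hd = suc zero

IsSimple : ∀ {t k} → Orient t k → Set
IsSimple {t} {k} a =
  (∀ i → a i tl ≢ a i hd) ×
  (∀ i j → i ≢ j →
     ¬ ((a i tl ≡ a j tl × a i hd ≡ a j hd) ⊎ (a i tl ≡ a j hd × a i hd ≡ a j tl)))

HAdj : ∀ {t k} → Orient t k → Fin t → Fin t → Set
HAdj {t} {k} a b c =
  Σ (Fin k) λ i → (a i tl ≡ b × a i hd ≡ c) ⊎ (a i tl ≡ c × a i hd ≡ b)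

IsConnectedH : ∀ {t k} → Orient t k → Set
IsConnectedH {t} a = (b c : Fin t) → Star (HAdj a) b c

allPos : (k : ℕ) → List (Pos k)
allPos k = cartesianProduct (allFin k) (allFin 2)

degree : ∀ {t k} → Orient t k → Fin t → ℕ
degree {t} {k} a b = length (filter (λ p → a (Data.Product.proj₁ p) (Data.Product.proj₂ p) ≟ b) (allPos k))

NoLeaves : ∀ {t k} → Orient t k → Set
NoLeaves {t} a = (b : Fin t) → degree a b ≢ 1

-- A k-tuple of directed edges of the symmetric digraph of G:
-- v i tl = v_{2i-1}, v i hd = v_{2i}, with v_{2i-1} v_{2i} an edge of G.
EdgeTuple : ∀ {n} → SimpleGraph n → ℕ → Set
EdgeTuple {n} G k =
  Σ (Fin k → Fin 2 → Fin n) λ v → (i : Fin k) → Adj G (v i tl) (v i hd)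

Condition1 : ∀ {t k n} → Orient t k → (v w : Fin k → Fin 2 → Fin n) → Fin t → Set
Condition1 {t} {k} a v w b =
  (i j : Fin k) (s r : Fin 2) → a i s ≡ b → a j r ≡ b →
  (v i s ≡ v j r) × (w i s ≡ w j r)

Condition3 : ∀ {t k n} → Orient t k → (v w : Fin k → Fin 2 → Fin n) → Fin t → Set
Condition3 {t} {k} {n} a v w b =
  Σ (Fin n) λ x → Σ (Fin n) λ y →
  (i : Fin k) (s : Fin 2) → a i s ≡ b →
  (v i s ≡ x × w i s ≡ y) ⊎ (v i s ≡ y × w i s ≡ x)

-- The undirected subgraph K of G formed by the edges v_{2i-1}v_{2i}, w_{2i-1}w_{2i}.
KVertex : ∀ {k n} → (v w : Fin k → Fin 2 → Fin n) → Fin n → Set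
KVertex {k} v w x = Σ (Fin k) λ i → Σ (Fin 2) λ s → (v i s ≡ x) ⊎ (w i s ≡ x)

KAdj : ∀ {k n} → (v w : Fin k → Fin 2 → Fin n) → Fin n → Fin n → Set
KAdj {k} v w x y =
  Σ (Fin k) λ i →
    ((v i tl ≡ x × v i hd ≡ y) ⊎ (v i tl ≡ y × v i hd ≡ x)) ⊎
    ((w i tl ≡ x × w i hd ≡ y) ⊎ (w i tl ≡ y × w i hd ≡ x))

KConnected : ∀ {k n} → (v w : Fin k → Fin 2 → Fin n) → Set
KConnected {k} {n} v w =
  (x y : Fin n) → KVertex v w x → KVertex v w y → Star (KAdj v w) x y

-- If k ≤ t, the degrees of H sum to 2k ≤ 2t while none is below 2, so H is a cycle and every
-- vertex carries exactly two positions. Suppose b₀ is the only vertex violating Condition 1;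
-- Condition 3 then says its two positions p, q carry (x, y) and (y, x). Follow the cycle from p:
-- each edge of H gives an edge of K, and Condition 1 at every other vertex transfers the current
-- value of v to the next edge. The walk must come back to b₀, and it cannot do so through p again
-- (reversing the edges reflects the walk), so it arrives at q, giving a K-walk from x to y.
-- Thus all values at b₀ are reachable from x, and connectivity of H spreads this to all of K.
module Submission where

open import Defs hiding (sym)
open import Data.Nat using (ℕ; zero; suc; _+_; _*_; _≤_; _<_; _<?_; z≤n; s≤s)
import Data.Nat.Properties as ℕ
open import Data.Fin using (Fin; zero; suc; toℕ; punchIn; combine; _≟_)
open import Data.Fin.Properties using (punchInᵢ≢i; pigeonhole; combine-injective; all?; any?; ¬∀⟶∃¬)
open import Data.Product using (Σ; ∃; ∃₂; _×_; _,_; proj₁; proj₂)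
open import Data.Sum using (_⊎_; inj₁; inj₂; swap; [_,_]′)
open import Data.Empty using (⊥-elim)
open import Data.Bool using (if_then_else_)
open import Data.List using (List; []; _∷_; length; filter; allFin; cartesianProduct)
open import Data.List.Properties using (length-tabulate)
open import Data.List.Membership.Propositional using (_∈_)
open import Data.List.Membership.Propositional.Properties
  using (∈-filter⁺; ∈-filter⁻; ∈-cartesianProduct⁺; ∈-allFin; ∈-length)
open import Data.List.Relation.Unary.Any using (here; there)
open import Data.List.Relation.Unary.All using ([]; _∷_)
open import Data.List.Relation.Unary.AllPairs using (_∷_)
open import Data.List.Relation.Unary.Unique.Propositional using (Unique)
import Data.List.Relation.Unary.Unique.Propositional.Properties as Unique
open import Function using (Injective; _∘_; id)
open import Relation.Nullary using (¬_; Dec; yes; no; does)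
open import Relation.Nullary.Decidable using (dec-true; dec-false; decidable-stable; _×-dec_; _→-dec_; ¬?)
open import Relation.Unary using (Pred; Decidable)
open import Relation.Binary.PropositionalEquality
open import Relation.Binary.Construct.Closure.ReflexiveTransitive using (Star; ε; _◅_; _◅◅_; reverse)
open import Algebra.Properties.CommutativeMonoid.Sum ℕ.+-0-commutativeMonoid
  using (sum; sum-remove; ∑-distrib-+; sum-cong-≗; sum-replicate-zero)

indicator : ∀ {t} → Fin t → Fin t → ℕ
indicator c b = if does (c ≟ b) then 1 else 0

sum-indicator : ∀ {t} (c : Fin t) → sum (indicator c) ≡ 1
sum-indicator {suc t} c = begin
  sum (indicator c)                                      ≡⟨ sum-remove {i = c} (indicator c) ⟩
  indicator c c + sum (λ j → indicator c (punchIn c j))  ≡⟨ cong₂ _+_ on-diagonal (sum-cong-≗ off-diagonal) ⟩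
  1 + sum {t} (λ _ → 0)                                  ≡⟨ cong suc (sum-replicate-zero t) ⟩
  1                                                      ∎
  where
  open ≡-Reasoning
  on-diagonal : indicator c c ≡ 1
  on-diagonal = cong (if_then 1 else 0) (dec-true (c ≟ c) refl)
  off-diagonal : ∀ j → indicator c (punchIn c j) ≡ 0
  off-diagonal j = cong (if_then 1 else 0) (dec-false (c ≟ punchIn c j) (punchInᵢ≢i c j ∘ sym))

*-≤-sum : ∀ {t m} (f : Fin t → ℕ) → (∀ b → m ≤ f b) → t * m ≤ sum f
*-≤-sum {zero}  f m≤f = z≤n
*-≤-sum {suc t} f m≤f = ℕ.+-mono-≤ (m≤f zero) (*-≤-sum (f ∘ suc) (m≤f ∘ suc))

≤-pointwise∧sum≤*⇒≡ : ∀ {t m} (f : Fin t → ℕ) → (∀ b → m ≤ f b) → sum f ≤ t * m → ∀ b → f b ≡ m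
≤-pointwise∧sum≤*⇒≡ {suc t} {m} f m≤f sum≤ b = ℕ.≤-antisym f[b]≤m (m≤f b)
  where
  open ℕ.≤-Reasoning
  f[b]≤m : f b ≤ m
  f[b]≤m = ℕ.+-cancelʳ-≤ (t * m) (f b) m (begin
    f b + t * m                        ≤⟨ ℕ.+-monoʳ-≤ (f b) (*-≤-sum _ (m≤f ∘ punchIn b)) ⟩
    f b + sum (λ j → f (punchIn b j))  ≡⟨ sum-remove {i = b} f ⟨
    sum f                              ≤⟨ sum≤ ⟩
    m + t * m                          ∎)

module _ {t} {X : Set} (A : X → Fin t) where

  count : List X → Fin t → ℕ
  count xs b = length (filter (λ x → A x ≟ b) xs)

  count-∷ : ∀ x xs b → count (x ∷ xs) b ≡ indicator (A x) b + count xs b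
  count-∷ x xs b with A x ≟ b
  ... | yes _ = refl
  ... | no _  = refl

  sum-count : ∀ xs → sum (count xs) ≡ length xs
  sum-count []       = sum-replicate-zero t
  sum-count (x ∷ xs) = begin
    sum (count (x ∷ xs))                         ≡⟨ sum-cong-≗ (count-∷ x xs) ⟩
    sum (λ b → indicator (A x) b + count xs b)  ≡⟨ ∑-distrib-+ (indicator (A x)) (count xs) ⟩
    sum (indicator (A x)) + sum (count xs)       ≡⟨ cong₂ _+_ (sum-indicator (A x)) (sum-count xs) ⟩
    suc (length xs)                              ∎
    where open ≡-Reasoning

ExactlyTwo : ∀ {X : Set} {p} → Pred X p → Set _
ExactlyTwo {X} P = ∃₂ λ (x y : X) → x ≢ y × P x × P y × (∀ {z} → P z → z ≡ x ⊎ z ≡ y)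

module _ {X : Set} {p} {P : Pred X p} where

  filter-length-two : (P? : Decidable P) → ∀ {xs} → Unique xs → (∀ {x} → P x → x ∈ xs) →
                      length (filter P? xs) ≡ 2 → ExactlyTwo P
  filter-length-two P? {xs} uniq complete len with filter P? xs in eq | Unique.filter⁺ P? uniq
  ... | x ∷ y ∷ [] | (x≢y ∷ []) ∷ _ = x , y , x≢y , P-of (here refl) , P-of (there (here refl)) , cover
    where
    P-of : ∀ {z} → z ∈ x ∷ y ∷ [] → P z
    P-of z∈ = proj₂ (∈-filter⁻ P? {xs = xs} (subst (_ ∈_) (sym eq) z∈))
    cover : ∀ {z} → P z → z ≡ x ⊎ z ≡ y
    cover Pz with subst (_ ∈_) eq (∈-filter⁺ P? (complete Pz) Pz)
    ... | here z≡x         = inj₁ z≡x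
    ... | there (here z≡y) = inj₂ z≡y

  the-other : ExactlyTwo P → ∀ {z} → P z → ∃ λ z′ → P z′ × z′ ≢ z × (∀ {u} → P u → u ≡ z ⊎ u ≡ z′)
  the-other (x , y , x≢y , Px , Py , cover) Pz with cover Pz
  ... | inj₁ refl = y , Py , x≢y ∘ sym , cover
  ... | inj₂ refl = x , Px , x≢y , swap ∘ cover

record TwoToOne {X B : Set} (A : X → B) : Set where
  field
    partner        : X → X
    partner-fibre  : ∀ x → A (partner x) ≡ A x
    partner-≢      : ∀ x → partner x ≢ x
    partner-covers : ∀ x {y} → A y ≡ A x → y ≡ x ⊎ y ≡ partner x

  partner-involutive : ∀ x → partner (partner x) ≡ x
  partner-involutive x with partner-covers (partner x) (sym (partner-fibre x))
  ... | inj₁ x≡px   = ⊥-elim (partner-≢ x (sym x≡px))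
  ... | inj₂ x≡ppx  = sym x≡ppx

  partner-swap : ∀ {x y} → partner x ≡ y → x ≡ partner y
  partner-swap {x} px≡y = trans (sym (partner-involutive x)) (cong partner px≡y)

  partner-injective : Injective _≡_ _≡_ partner
  partner-injective {x} {y} px≡py = begin
    x                    ≡⟨ partner-involutive x ⟨
    partner (partner x)  ≡⟨ cong partner px≡py ⟩
    partner (partner y)  ≡⟨ partner-involutive y ⟩
    y                    ∎
    where open ≡-Reasoning

count≡2⇒TwoToOne : ∀ {t} {X : Set} (A : X → Fin t) (xs : List X) → Unique xs → (∀ x → x ∈ xs) →
                   (∀ b → count A xs b ≡ 2) → TwoToOne A
count≡2⇒TwoToOne A xs uniq complete count≡2 = record
  { partner        = λ x → proj₁ (other x)
  ; partner-fibre  = λ x → proj₁ (proj₂ (other x))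
  ; partner-≢      = λ x → proj₁ (proj₂ (proj₂ (other x)))
  ; partner-covers = λ x → proj₂ (proj₂ (proj₂ (other x)))
  }
  where
  other : ∀ x → ∃ λ y → A y ≡ A x × y ≢ x × (∀ {z} → A z ≡ A x → z ≡ x ⊎ z ≡ y)
  other x = the-other (filter-length-two (λ y → A y ≟ A x) uniq (λ {y} _ → complete y) (count≡2 (A x))) refl

module Orbit {X : Set} (f : X → X) where

  iterate : ℕ → X → X
  iterate zero    x = x
  iterate (suc j) x = f (iterate j x)

  iterate-cancel : Injective _≡_ _≡_ f → ∀ i d {x} → iterate (i + d) x ≡ iterate i x → iterate d x ≡ x
  iterate-cancel f-inj zero    d eq = eq
  iterate-cancel f-inj (suc i) d eq = iterate-cancel f-inj i d (f-inj eq)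

  orbit-returns : ∀ {m} (enc : X → Fin m) → Injective _≡_ _≡_ enc → Injective _≡_ _≡_ f →
                  ∀ x → ∃ λ e → f (iterate e x) ≡ x
  orbit-returns {m} enc enc-inj f-inj x
    with i , j , i<j , same ← pigeonhole (ℕ.n<1+n m) (λ i → enc (iterate (toℕ i) x))
    with e , i+1+e≡j ← ℕ.m≤n⇒∃[o]m+o≡n i<j =
    e , iterate-cancel f-inj (toℕ i) (suc e) (begin
      iterate (toℕ i + suc e) x  ≡⟨ cong (λ n → iterate n x) (trans (ℕ.+-suc (toℕ i) e) i+1+e≡j) ⟩
      iterate (toℕ j) x          ≡⟨ enc-inj same ⟨
      iterate (toℕ i) x          ∎)
    where open ≡-Reasoning

-- When f ∘ r ∘ f = r, the involution r maps an orbit segment from x to r x onto itself reversed,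
-- so its middle is a fixed point of r or a point y with f y ≡ r y.
module Reversal {X : Set} (f r : X → X)
                (r-involutive : ∀ x → r (r x) ≡ x)
                (f-r-f : ∀ x → f (r (f x)) ≡ r x) where
  open Orbit f

  reverse-step : ∀ {y z} → f y ≡ r z → y ≡ r (f z)
  reverse-step {y} {z} fy≡rz = begin
    y                ≡⟨ r-involutive y ⟨
    r (r y)          ≡⟨ cong r (f-r-f y) ⟨
    r (f (r (f y)))  ≡⟨ cong (r ∘ f ∘ r) fy≡rz ⟩
    r (f (r (r z)))  ≡⟨ cong (r ∘ f) (r-involutive z) ⟩
    r (f z)          ∎
    where open ≡-Reasoning

  module _ (r-free : ∀ x → r x ≢ x) (f≢r : ∀ x → f x ≢ r x) where

    no-reflected-pair : ∀ d i {x} → iterate (d + i) x ≢ r (iterate i x)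
    no-reflected-pair zero          i eq = r-free _ (sym eq)
    no-reflected-pair (suc zero)    i eq = f≢r _ eq
    no-reflected-pair (suc (suc d)) i {x} eq =
      no-reflected-pair d (suc i) (trans (cong (λ n → iterate n x) (ℕ.+-suc d i)) (reverse-step eq))

    iterate-≢-r : ∀ j {x} → iterate j x ≢ r x
    iterate-≢-r j {x} eq =
      no-reflected-pair j 0 (trans (cong (λ n → iterate n x) (ℕ.+-identityʳ j)) eq)

flipEnd : Fin 2 → Fin 2
flipEnd zero       = suc zero
flipEnd (suc zero) = zero

across : ∀ {k} → Pos k → Pos k
across (i , s) = i , flipEnd s

across-involutive : ∀ {k} (π : Pos k) → across (across π) ≡ π
across-involutive (i , zero)     = refl
across-involutive (i , suc zero) = refl

across-≢ : ∀ {k} (π : Pos k) → across π ≢ π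
across-≢ (i , zero)     ()
across-≢ (i , suc zero) ()

endpoint : ∀ {t k} → Orient t k → Pos k → Fin t
endpoint a π = a (proj₁ π) (proj₂ π)

∈-allPos : ∀ {k} (π : Pos k) → π ∈ allPos k
∈-allPos (i , s) = ∈-cartesianProduct⁺ (∈-allFin i) (∈-allFin s)

allPos-unique : ∀ k → Unique (allPos k)
allPos-unique k = Unique.cartesianProduct⁺ (Unique.allFin⁺ k) (Unique.allFin⁺ 2)

length-allPos : ∀ k → length (allPos k) ≡ k * 2
length-allPos k = trans (length-× (allFin k)) (cong (_* 2) (length-tabulate {n = k} (λ i → i)))
  where
  length-× : (is : List (Fin k)) → length (cartesianProduct is (allFin 2)) ≡ length is * 2
  length-× []       = refl
  length-× (i ∷ is) = cong (λ n → suc (suc n)) (length-× is)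

module _ {t k} (a : Orient t k) (connected : IsConnectedH a) (noLeaves : NoLeaves a) where

  incident-position : Pos k → ∀ b → ∃ λ π → endpoint a π ≡ b
  incident-position π b with connected b (endpoint a π)
  ... | ε                              = π , refl
  ... | (i , inj₁ (tl≡b , _)) ◅ _      = (i , tl) , tl≡b
  ... | (i , inj₂ (_ , hd≡b)) ◅ _      = (i , hd) , hd≡b

  2≤degree : Pos k → ∀ b → 2 ≤ degree a b
  2≤degree π b with incident-position π b
  ... | σ , σ↦b = 0<d∧d≢1⇒2≤d
    (∈-length (∈-filter⁺ (λ σ → endpoint a σ ≟ b) (∈-allPos σ) σ↦b)) (noLeaves b)
    where
    0<d∧d≢1⇒2≤d : ∀ {d} → 0 < d → d ≢ 1 → 2 ≤ d
    0<d∧d≢1⇒2≤d {suc zero}    _ d≢1 = ⊥-elim (d≢1 refl)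
    0<d∧d≢1⇒2≤d {suc (suc d)} _ _   = s≤s (s≤s z≤n)

  -- Handshake: the degrees sum to 2k ≤ 2t while each is at least 2, so H is 2-regular.
  degree≡2 : k ≤ t → Pos k → ∀ b → degree a b ≡ 2
  degree≡2 k≤t π = ≤-pointwise∧sum≤*⇒≡ (degree a) (2≤degree π) (begin
    sum (degree a)      ≡⟨ sum-count (endpoint a) (allPos k) ⟩
    length (allPos k)   ≡⟨ length-allPos k ⟩
    k * 2               ≤⟨ ℕ.*-monoˡ-≤ 2 k≤t ⟩
    t * 2               ∎)
    where open ℕ.≤-Reasoning

  two-regular : k ≤ t → Pos k → TwoToOne (endpoint a)
  two-regular k≤t π = count≡2⇒TwoToOne (endpoint a) (allPos k) (allPos-unique k) ∈-allPos (degree≡2 k≤t π)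

condition1? : ∀ {t k n} (a : Orient t k) (v w : Fin k → Fin 2 → Fin n) b → Dec (Condition1 a v w b)
condition1? a v w b =
  all? λ i → all? λ j → all? λ s → all? λ r →
    (a i s ≟ b) →-dec ((a j r ≟ b) →-dec ((v i s ≟ v j r) ×-dec (w i s ≟ w j r)))

¬Condition1⇒position : ∀ {t k n} (a : Orient t k) (v w : Fin k → Fin 2 → Fin n) {b} →
                       ¬ Condition1 a v w b → ∃ λ π → endpoint a π ≡ b
¬Condition1⇒position a v w {b} ¬c1 with any? (λ i → any? (λ s → a i s ≟ b))
... | yes (i , s , is↦b) = (i , s) , is↦b
... | no none            = ⊥-elim (¬c1 (λ i _ s _ is↦b _ → ⊥-elim (none (i , s , is↦b))))

module SingleDefect {t k n} (a : Orient t k) (connected : IsConnectedH a) (pairing : TwoToOne (endpoint a))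
                    (v w : Fin k → Fin 2 → Fin n) (b₀ : Fin t)
                    (¬c1 : ¬ Condition1 a v w b₀) (c3 : Condition3 a v w b₀)
                    (c1-elsewhere : ∀ c → c ≢ b₀ → Condition1 a v w c) where

  open TwoToOne pairing

  A : Pos k → Fin t
  A = endpoint a

  V W : Pos k → Fin n
  V π = v (proj₁ π) (proj₂ π)
  W π = w (proj₁ π) (proj₂ π)

  K-edge-V : ∀ π → KAdj v w (V π) (V (across π))
  K-edge-V (i , zero)     = i , inj₁ (inj₁ (refl , refl))
  K-edge-V (i , suc zero) = i , inj₁ (inj₂ (refl , refl))

  K-edge-W : ∀ π → KAdj v w (W π) (W (across π))
  K-edge-W (i , zero)     = i , inj₂ (inj₁ (refl , refl))
  K-edge-W (i , suc zero) = i , inj₂ (inj₂ (refl , refl))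

  K-sym : ∀ {x y} → KAdj v w x y → KAdj v w y x
  K-sym (i , inj₁ e) = i , inj₁ (swap e)
  K-sym (i , inj₂ e) = i , inj₂ (swap e)

  agree-off-b₀ : ∀ σ τ → A σ ≢ b₀ → A τ ≡ A σ → V σ ≡ V τ × W σ ≡ W τ
  agree-off-b₀ σ τ σ↦̸b₀ τ↦ = c1-elsewhere (A σ) σ↦̸b₀ (proj₁ σ) (proj₁ τ) (proj₂ σ) (proj₂ τ) refl τ↦

  position-at-b₀ : ∃ λ π → A π ≡ b₀
  position-at-b₀ = ¬Condition1⇒position a v w ¬c1

  p q : Pos k
  p = proj₁ position-at-b₀
  q = partner p

  p↦b₀ : A p ≡ b₀
  p↦b₀ = proj₂ position-at-b₀

  at-b₀ : ∀ σ → A σ ≡ b₀ → σ ≡ p ⊎ σ ≡ q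
  at-b₀ σ σ↦b₀ = partner-covers p (trans σ↦b₀ (sym p↦b₀))

  constant-at-b₀ : ∀ {x y} → V p ≡ x × W p ≡ y → V q ≡ x × W q ≡ y → Condition1 a v w b₀
  constant-at-b₀ {x} {y} p-xy q-xy i j s r is↦b₀ jr↦b₀ =
    trans (proj₁ (value (i , s) is↦b₀)) (sym (proj₁ (value (j , r) jr↦b₀))) ,
    trans (proj₂ (value (i , s) is↦b₀)) (sym (proj₂ (value (j , r) jr↦b₀)))
    where
    value : ∀ σ → A σ ≡ b₀ → V σ ≡ x × W σ ≡ y
    value σ σ↦b₀ with at-b₀ σ σ↦b₀
    ... | inj₁ refl = p-xy
    ... | inj₂ refl = q-xy

  swapped-at-b₀ : V p ≡ W q × W p ≡ V q
  swapped-at-b₀ with proj₂ (proj₂ c3) (proj₁ p) (proj₂ p) p↦b₀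
                   | proj₂ (proj₂ c3) (proj₁ q) (proj₂ q) (trans (partner-fibre p) p↦b₀)
  ... | inj₁ (Vp , Wp) | inj₂ (Vq , Wq) = trans Vp (sym Wq) , trans Wp (sym Vq)
  ... | inj₂ (Vp , Wp) | inj₁ (Vq , Wq) = trans Vp (sym Wq) , trans Wp (sym Vq)
  ... | inj₁ p-xy      | inj₁ q-xy      = ⊥-elim (¬c1 (constant-at-b₀ p-xy q-xy))
  ... | inj₂ p-yx      | inj₂ q-yx      = ⊥-elim (¬c1 (constant-at-b₀ p-yx q-yx))

  Reach : Fin n → Set
  Reach = Star (KAdj v w) (V p)

  -- Walking around the cycle H from p: cross an edge, then move to the other position at its far end.
  next : Pos k → Pos k
  next = partner ∘ across

  open Orbit next

  next-injective : Injective _≡_ _≡_ next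
  next-injective {π} {σ} eq = begin
    π                    ≡⟨ across-involutive π ⟨
    across (across π)    ≡⟨ cong across (partner-injective eq) ⟩
    across (across σ)    ≡⟨ across-involutive σ ⟩
    σ                    ∎
    where open ≡-Reasoning

  next-across-next : ∀ π → next (across (next π)) ≡ across π
  next-across-next π = trans (cong partner (across-involutive (partner (across π))))
                             (partner-involutive (across π))

  open Reversal next across across-involutive next-across-next

  orbit-avoids-across-p : ∀ j → iterate j p ≢ across p
  orbit-avoids-across-p j = iterate-≢-r across-≢ (λ π → partner-≢ (across π)) j

  extend-V : ∀ {z} π → Star (KAdj v w) z (V π) → Star (KAdj v w) z (V (across π))
  extend-V π r = r ◅◅ (K-edge-V π ◅ ε)

  extend-W : ∀ {z} π → Star (KAdj v w) z (W π) → Star (KAdj v w) z (W (across π))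
  extend-W π r = r ◅◅ (K-edge-W π ◅ ε)

  reach-along-orbit : ∀ j → Reach (V q) ⊎ Reach (V (iterate j p))
  reach-along-orbit zero    = inj₂ ε
  reach-along-orbit (suc j) with reach-along-orbit j
  ... | inj₁ reach-q = inj₁ reach-q
  ... | inj₂ reach-j with extend-V (iterate j p) reach-j | A (across (iterate j p)) ≟ b₀
  ...   | reach-σ | no σ↦̸b₀ = inj₂ (subst Reach (proj₁ (agree-off-b₀ _ _ σ↦̸b₀ (partner-fibre _))) reach-σ)
  ...   | reach-σ | yes σ↦b₀ with at-b₀ (across (iterate j p)) σ↦b₀
  ...     | inj₁ σ≡p = ⊥-elim (orbit-avoids-across-p j
                         (trans (sym (across-involutive (iterate j p))) (cong across σ≡p)))
  ...     | inj₂ σ≡q = inj₁ (subst Reach (cong V σ≡q) reach-σ)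

  encode : Pos k → Fin (k * 2)
  encode (i , s) = combine i s

  encode-injective : Injective _≡_ _≡_ encode
  encode-injective {i , s} {j , r} eq with refl , refl ← combine-injective i s j r eq = refl

  -- The orbit of p returns to p, so some step of it enters b₀, necessarily at q.
  reach-q : Reach (V q)
  reach-q with e , next-e≡p ← orbit-returns encode encode-injective next-injective p
    with reach-along-orbit e
  ... | inj₁ reach-q = reach-q
  ... | inj₂ reach-e = subst Reach (cong V (partner-swap next-e≡p)) (extend-V (iterate e p) reach-e)

  Good : Fin t → Set
  Good c = ∀ π → A π ≡ c → Reach (V π) × Reach (W π)

  good-b₀ : Good b₀
  good-b₀ π π↦b₀ with at-b₀ π π↦b₀
  ... | inj₁ refl = ε , subst Reach (sym (proj₂ swapped-at-b₀)) reach-q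
  ... | inj₂ refl = reach-q , subst Reach (proj₁ swapped-at-b₀) ε

  good-across : ∀ σ {c d} → A σ ≡ c → A (across σ) ≡ d → Good c → Good d
  good-across σ refl refl good π π↦ with A (across σ) ≟ b₀
  ... | yes σ′↦b₀ = good-b₀ π (trans π↦ σ′↦b₀)
  ... | no σ′↦̸b₀ =
    subst Reach (proj₁ agree) (extend-V σ (proj₁ (good σ refl))) ,
    subst Reach (proj₂ agree) (extend-W σ (proj₂ (good σ refl)))
    where agree = agree-off-b₀ (across σ) π σ′↦̸b₀ π↦

  good-along : ∀ {c d} → Star (HAdj a) c d → Good c → Good d
  good-along ε                                 good = good
  good-along ((i , inj₁ (tl↦c , hd↦d)) ◅ path) good = good-along path (good-across (i , tl) tl↦c hd↦d good)
  good-along ((i , inj₂ (tl↦d , hd↦c)) ◅ path) good = good-along path (good-across (i , hd) hd↦c tl↦d good)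

  reach-K : ∀ {z} → KVertex v w z → Reach z
  reach-K (i , s , inj₁ refl) = proj₁ (good-along (connected b₀ (a i s)) good-b₀ (i , s) refl)
  reach-K (i , s , inj₂ refl) = proj₂ (good-along (connected b₀ (a i s)) good-b₀ (i , s) refl)

  K-connected : KConnected v w
  K-connected x y x∈K y∈K = reverse K-sym (reach-K x∈K) ◅◅ reach-K y∈K

lemma3p12 : (t k : ℕ) (a : Orient t k) → IsSimple a → IsConnectedH a → NoLeaves a →
            (n : ℕ) (G : SimpleGraph n) (T₁ T₂ : EdgeTuple G k) →
            ((b : Fin t) → Condition1 a (proj₁ T₁) (proj₁ T₂) b ⊎ Condition3 a (proj₁ T₁) (proj₁ T₂) b) →
            ¬ ((b : Fin t) → Condition1 a (proj₁ T₁) (proj₁ T₂) b) →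
            (t < k)
            ⊎ (Σ (Fin t) λ b → Σ (Fin t) λ c → b ≢ c × ¬ Condition1 a (proj₁ T₁) (proj₁ T₂) b × ¬ Condition1 a (proj₁ T₁) (proj₁ T₂) c)
            ⊎ KConnected (proj₁ T₁) (proj₁ T₂)
lemma3p12 t k a _ connected noLeaves n _ (v , _) (w , _) c1⊎c3 ¬all-c1 with t <? k
... | yes t<k = inj₁ t<k
... | no t≮k
  with b₀ , ¬c1 ← ¬∀⟶∃¬ t (Condition1 a v w) (condition1? a v w) ¬all-c1
  with any? (λ c → ¬? (c ≟ b₀) ×-dec ¬? (condition1? a v w c))
... | yes (c , c≢b₀ , ¬c1′) = inj₂ (inj₁ (b₀ , c , ≢-sym c≢b₀ , ¬c1 , ¬c1′))
... | no no-other = inj₂ (inj₂ (SingleDefect.K-connected a connected pairing v w b₀ ¬c1 c3 c1-elsewhere))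
  where
  pairing : TwoToOne (endpoint a)
  pairing = two-regular a connected noLeaves (ℕ.≮⇒≥ t≮k) (proj₁ (¬Condition1⇒position a v w ¬c1))
  c3 : Condition3 a v w b₀
  c3 = [ ⊥-elim ∘ ¬c1 , id ]′ (c1⊎c3 b₀)
  c1-elsewhere : ∀ c → c ≢ b₀ → Condition1 a v w c
  c1-elsewhere c c≢b₀ = decidable-stable (condition1? a v w c) (λ ¬c1′ → no-other (c , c≢b₀ , ¬c1′))
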